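{- For the complete graph $K_n$ on $n$ vertices, $\operatorname{ept}(K_n)=\Omega(\log\log n)$ as $n\to\infty$.
   Context: Probabilistic zero forcing on a graph $G$: vertices are colored blue or white. The process proceeds in rounds $1,2,3,\dots$. In a round, let $B$ be the set of blue vertices at the start of the round; each blue vertex $u$ fires at each of its white neighbors $w$, and each such fire succeeds independently with probability $|N[u]\cap B|/\deg u$, where $N[u]$ is the closed neighborhood of $u$. At the end of the round, every white vertex at which at least one fire succeeded becomes blue. For a connected graph $G$ and nonempty $Z\subseteq V(G)$, $\mathrm{pt}_{\rm pzf}(G,Z)$ is the random variable equal to the number of the round in which the last white vertex turns blue when starting with exactly $Z$ blue; $\operatorname{ept}(G,Z)=\mathbf{E}[\mathrm{pt}_{\rm pzf}(G,Z)]$ and $\operatorname{ept}(G)=\min_{v\in V(G)}\operatorname{ept}(G,\{v\})$. -}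

module Defs where

open import Data.Nat as ℕ using (ℕ; zero; suc)
open import Data.Bool using (Bool; true; false; if_then_else_; _∧_; _∨_; not)
open import Data.Fin using (Fin; zero; suc; _≟_)
open import Data.List using (List; []; _∷_; map; filter; length; foldr; concatMap; allFin)
open import Data.Integer using (+_)
open import Data.Rational using (ℚ; 0ℚ; 1ℚ; _+_; _*_; _-_; _/_)
open import Relation.Nullary.Decidable using (isYes)
open import Data.Nat.Logarithm using (⌊log₂_⌋)

-- A (simple, loopless) graph on vertex set Fin n, given by its adjacency
-- predicate.  A set of vertices is a Boolean predicate on Fin n.
Graph : ℕ → Set
Graph n = Fin n → Fin n → Bool

VSet : ℕ → Set
VSet n = Fin n → Bool

K : (n : ℕ) → Graph n
K n i j = not (isYes (i ≟ j))

sumℚ : List ℚ → ℚ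
sumℚ = foldr _+_ 0ℚ

prodℚ : List ℚ → ℚ
prodℚ = foldr _*_ 1ℚ

count : {n : ℕ} → (Fin n → Bool) → ℕ
count {n} P = length (filter (λ v → Data.Bool._≟_ (P v) true) (allFin n))
  where import Data.Bool

deg : {n : ℕ} → Graph n → Fin n → ℕ
deg G u = count (G u)

closedBlue : {n : ℕ} → Graph n → VSet n → Fin n → ℕ
closedBlue G B u = count (λ v → (isYes (v ≟ u) ∨ G u v) ∧ B v)

-- success probability of each fire of u : |N[u] ∩ B| / deg u
-- (deg u = 0 only for isolated vertices, which never fire; value irrelevant)
fireProb : {n : ℕ} → Graph n → VSet n → Fin n → ℚ
fireProb G B u with deg G u
... | zero  = 0ℚ
... | suc d = (+ closedBlue G B u) / suc d

-- probability that a white vertex w receives no successful fire in a round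
-- starting from blue set B
stayWhite : {n : ℕ} → Graph n → VSet n → Fin n → ℚ
stayWhite {n} G B w =
  prodℚ (map (λ u → if B u ∧ G u w then 1ℚ - fireProb G B u else 1ℚ) (allFin n))

-- one-round transition probability from blue set B to blue set B'
-- (independence of all fires across white vertices)
trans : {n : ℕ} → Graph n → VSet n → VSet n → ℚ
trans {n} G B B' = prodℚ (map factor (allFin n))
  where
  factor : Fin n → ℚ
  factor w = if B w
             then (if B' w then 1ℚ else 0ℚ)
             else (if B' w then 1ℚ - stayWhite G B w else stayWhite G B w)

allSets : (n : ℕ) → List (VSet n)
allSets zero = (λ ()) ∷ []
allSets (suc n) = concatMap (λ S → ext false S ∷ ext true S ∷ []) (allSets n)
  where
  ext : Bool → VSet n → VSet (suc n)
  ext b S zero = b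
  ext b S (suc i) = S i

eqSet : {n : ℕ} → VSet n → VSet n → Bool
eqSet {n} A B = foldr _∧_ true (map (λ i → isYes (Data.Bool._≟_ (A i) (B i))) (allFin n))
  where import Data.Bool

dist : {n : ℕ} → Graph n → VSet n → ℕ → VSet n → ℚ
dist G Z zero B = if eqSet B Z then 1ℚ else 0ℚ
dist {n} G Z (suc t) B' = sumℚ (map (λ B → dist G Z t B * trans G B B') (allSets n))

full : {n : ℕ} → VSet n
full _ = true

-- P(pt_pzf(G,Z) > t) = P(not all vertices blue after t rounds)
tailProb : {n : ℕ} → Graph n → VSet n → ℕ → ℚ
tailProb G Z t = 1ℚ - dist G Z t full

-- partial sums  Σ_{t=0}^{T} P(pt > t);  ept(G,Z) = sup_T partialEpt G Z T
partialEpt : {n : ℕ} → Graph n → VSet n → ℕ → ℚ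
partialEpt G Z zero = tailProb G Z zero
partialEpt G Z (suc T) = partialEpt G Z T + tailProb G Z (suc T)

single : {n : ℕ} → Fin n → VSet n
single v u = isYes (u ≟ v)

-- ept(G,Z) ≥ x  (with x approached from below by the partial sums):
-- we use "some partial sum reaches x", i.e. ept(G,Z) ≥ x witnessed finitely.
EptAtLeast : {n : ℕ} → Graph n → VSet n → ℚ → Set
EptAtLeast G Z x = Data.Product.∃ λ T → x Data.Rational.≤ partialEpt G Z T
  where import Data.Product; import Data.Rational

-- ept(G) ≥ x  iff  ept(G,{v}) ≥ x for every vertex v  (ept(G) is the minimum)
EptGAtLeast : {n : ℕ} → Graph n → ℚ → Set
EptGAtLeast {n} G x = (v : Fin n) → EptAtLeast G (single v) x

loglog : ℕ → ℕ
loglog n = ⌊log₂ ⌊log₂ n ⌋ ⌋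

module Submission where

-- On K_n a blue vertex fires with success probability |B|/(n-1), so by the union bound a
-- white vertex turns blue with probability at most |B|²/(n-1), and the expected number of
-- blue vertices after a round from B is at most |B| + 2|B|². With m₀ = 1 and
-- m_{t+1} = 3 m_t² 2^{t+2}, Markov's inequality gives
-- P(|B_{t+1}| > m_{t+1}) ≤ P(|B_t| > m_t) + 2^{-(t+2)}, hence P(|B_t| > m_t) < 1/2 for all t.
-- Since m_t ≤ 2^{2^{t+3}}, the process is still running with probability at least 1/2 for
-- every t ≤ loglog n - 3, so the partial sums of P(pt > t) reach (loglog n)/8.

open import Defs
open import Data.Nat using (ℕ; _≥_)
open import Data.Integer using (+_)
open import Data.Rational using (ℚ; Positive; _*_; _/_)
open import Data.Product using (Σ; ∃; _×_)

open import Data.Empty using (⊥-elim)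
open import Data.Bool as Bool using (Bool; true; false; if_then_else_; _∧_; _∨_; not)
open import Data.Fin using (Fin; zero; suc; _≟_)
open import Data.List using (List; []; _∷_; map; filter; length; foldr; concatMap; allFin; tabulate; _++_)
import Data.List.Properties as List
import Data.Integer as ℤ
import Data.Integer.Properties as ℤ
import Data.Nat as ℕ
open import Data.Nat using (zero; suc; z≤n; s≤s)
import Data.Nat.Properties as ℕ
open import Data.Nat.Induction using (<-wellFounded)
open import Data.Nat.Logarithm using (⌊log₂_⌋; ⌊log₂⌋-mono-≤)
open import Data.Nat.Logarithm.Core using (⌊log2⌋)
import Data.Nat.Solver as ℕSolver
open import Data.Product using (_,_; proj₁; proj₂)
open import Data.Rational using (0ℚ; 1ℚ; ½; _+_; _-_; _≤_; _<_; toℚᵘ; nonNegative; positive)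
import Data.Rational as ℚ
open import Data.Rational.Properties
  using (≤-refl; ≤-trans; ≤-reflexive; +-mono-≤; neg-antimono-≤; *-cancelʳ-≤-pos; *-cancelˡ-≤-pos)
import Data.Rational.Properties as ℚ
open import Data.Rational.Solver using (module +-*-Solver)
open +-*-Solver
import Data.Rational.Unnormalised as ℚᵘ
import Data.Rational.Unnormalised.Properties as ℚᵘ
open import Function using (id)
open import Induction.WellFounded using (Acc; acc)
open import Relation.Binary.PropositionalEquality
  using (_≡_; refl; sym; cong; cong₂; subst; _≗_; module ≡-Reasoning)
  renaming (trans to ≡-trans)
open import Relation.Nullary using (Dec; yes; no; ¬_; _because_)
open import Relation.Nullary.Decidable using (isYes)

0≤1 : 0ℚ ≤ 1ℚ
0≤1 = ℚ.≤ᵇ⇒≤ _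

0<1 : 0ℚ < 1ℚ
0<1 = ℚ.*<* (ℤ.+<+ (s≤s z≤n))

*-monoʳ-≤-0≤ : ∀ {r p q} → 0ℚ ≤ r → p ≤ q → p * r ≤ q * r
*-monoʳ-≤-0≤ {r} 0≤r = ℚ.*-monoʳ-≤-nonNeg r {{nonNegative 0≤r}}

*-monoˡ-≤-0≤ : ∀ {r p q} → 0ℚ ≤ r → p ≤ q → r * p ≤ r * q
*-monoˡ-≤-0≤ {r} 0≤r = ℚ.*-monoˡ-≤-nonNeg r {{nonNegative 0≤r}}

0≤* : ∀ {p q} → 0ℚ ≤ p → 0ℚ ≤ q → 0ℚ ≤ p * q
0≤* {p} {q} 0≤p 0≤q = ≤-trans (≤-reflexive (sym (ℚ.*-zeroˡ q))) (*-monoʳ-≤-0≤ 0≤q 0≤p)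

0≤1-_ : ∀ {x} → x ≤ 1ℚ → 0ℚ ≤ 1ℚ - x
0≤1-_ {x} x≤1 = ≤-trans (≤-reflexive (sym (ℚ.+-inverseʳ x))) (+-mono-≤ x≤1 ≤-refl)

1-_≤1 : ∀ {x} → 0ℚ ≤ x → 1ℚ - x ≤ 1ℚ
1-_≤1 {x} 0≤x = ≤-trans (+-mono-≤ (≤-refl {1ℚ}) (neg-antimono-≤ 0≤x)) (≤-reflexive (ℚ.+-identityʳ 1ℚ))

≤+0≤ : ∀ {p q} → 0ℚ ≤ q → p ≤ p + q
≤+0≤ {p} 0≤q = ≤-trans (≤-reflexive (sym (ℚ.+-identityʳ p))) (+-mono-≤ (≤-refl {p}) 0≤q)

fromℕ : ℕ → ℚ
fromℕ k = (+ k) / 1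

-- (+ k) / 1 normalises through a gcd computation that is stuck on a variable k, so the
-- homomorphism laws are proved in ℚᵘ.
private
  toℚᵘ-fromℕ : ∀ k → toℚᵘ (fromℕ k) ℚᵘ.≃ ℚᵘ.mkℚᵘ (+ k) 0
  toℚᵘ-fromℕ k = ℚ.toℚᵘ-fromℚᵘ (ℚᵘ.mkℚᵘ (+ k) 0)

fromℕ-suc : ∀ k → fromℕ (suc k) ≡ 1ℚ + fromℕ k
fromℕ-suc k = ℚ.toℚᵘ-injective (ℚᵘ.≃-trans (toℚᵘ-fromℕ (suc k)) (ℚᵘ.≃-trans 1+k
  (ℚᵘ.≃-sym (ℚᵘ.≃-trans (ℚ.toℚᵘ-homo-+ 1ℚ (fromℕ k)) (ℚᵘ.+-cong (toℚᵘ-fromℕ 1) (toℚᵘ-fromℕ k))))))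
  where
  1+k : ℚᵘ.mkℚᵘ (+ suc k) 0 ℚᵘ.≃ (ℚᵘ.mkℚᵘ (+ 1) 0 ℚᵘ.+ ℚᵘ.mkℚᵘ (+ k) 0)
  1+k = ℚᵘ.*≡* (cong (ℤ._* + 1) (cong (λ z → + 1 ℤ.+ z) (sym (ℤ.*-identityʳ (+ k)))))

/-*-fromℕ : ∀ a d → ((+ a) / suc d) * fromℕ (suc d) ≡ fromℕ a
/-*-fromℕ a d = ℚ.toℚᵘ-injective (ℚᵘ.≃-trans (ℚ.toℚᵘ-homo-* ((+ a) / suc d) (fromℕ (suc d)))
  (ℚᵘ.≃-trans (ℚᵘ.*-cong (ℚ.toℚᵘ-fromℚᵘ (ℚᵘ.mkℚᵘ (+ a) d)) (toℚᵘ-fromℕ (suc d)))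
  (ℚᵘ.≃-trans cancel (ℚᵘ.≃-sym (toℚᵘ-fromℕ a)))))
  where
  cancel : (ℚᵘ.mkℚᵘ (+ a) d ℚᵘ.* ℚᵘ.mkℚᵘ (+ suc d) 0) ℚᵘ.≃ ℚᵘ.mkℚᵘ (+ a) 0
  cancel = ℚᵘ.*≡* (≡-trans (ℤ.*-identityʳ _) (cong (λ z → + a ℤ.* + suc z) (sym (ℕ.*-identityʳ d))))

fromℕ-+ : ∀ a b → fromℕ (a ℕ.+ b) ≡ fromℕ a + fromℕ b
fromℕ-+ zero b = sym (ℚ.+-identityˡ (fromℕ b))
fromℕ-+ (suc a) b = begin
  fromℕ (suc (a ℕ.+ b))         ≡⟨ fromℕ-suc (a ℕ.+ b) ⟩
  1ℚ + fromℕ (a ℕ.+ b)          ≡⟨ cong (λ z → 1ℚ + z) (fromℕ-+ a b) ⟩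
  1ℚ + (fromℕ a + fromℕ b)      ≡⟨ sym (ℚ.+-assoc 1ℚ (fromℕ a) (fromℕ b)) ⟩
  (1ℚ + fromℕ a) + fromℕ b      ≡⟨ cong (_+ fromℕ b) (sym (fromℕ-suc a)) ⟩
  fromℕ (suc a) + fromℕ b       ∎
  where open ≡-Reasoning

fromℕ-* : ∀ a b → fromℕ (a ℕ.* b) ≡ fromℕ a * fromℕ b
fromℕ-* zero b = sym (ℚ.*-zeroˡ (fromℕ b))
fromℕ-* (suc a) b = begin
  fromℕ (b ℕ.+ a ℕ.* b)         ≡⟨ fromℕ-+ b (a ℕ.* b) ⟩
  fromℕ b + fromℕ (a ℕ.* b)     ≡⟨ cong (λ z → fromℕ b + z) (fromℕ-* a b) ⟩
  fromℕ b + fromℕ a * fromℕ b   ≡⟨ distrib (fromℕ a) (fromℕ b) ⟩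
  (1ℚ + fromℕ a) * fromℕ b      ≡⟨ cong (_* fromℕ b) (sym (fromℕ-suc a)) ⟩
  fromℕ (suc a) * fromℕ b       ∎
  where
  open ≡-Reasoning
  distrib : ∀ x y → y + x * y ≡ (1ℚ + x) * y
  distrib = solve 2 (λ x y → y :+ x :* y := (con 1ℚ :+ x) :* y) refl

0≤fromℕ : ∀ a → 0ℚ ≤ fromℕ a
0≤fromℕ zero = ≤-refl
0≤fromℕ (suc a) = subst (0ℚ ≤_) (sym (fromℕ-suc a)) (+-mono-≤ 0≤1 (0≤fromℕ a))

fromℕ-mono-≤ : ∀ {a b} → a ℕ.≤ b → fromℕ a ≤ fromℕ b
fromℕ-mono-≤ {a} a≤b with ℕ.m≤n⇒∃[o]m+o≡n a≤b
... | o , refl = ≤-trans (≤+0≤ (0≤fromℕ o)) (≤-reflexive (sym (fromℕ-+ a o)))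

fromℕ-pos : ∀ {a} → 1 ℕ.≤ a → Positive (fromℕ a)
fromℕ-pos 1≤a = positive (ℚ.<-≤-trans 0<1 (fromℕ-mono-≤ 1≤a))

sumℚ-++ : ∀ (xs ys : List ℚ) → sumℚ (xs ++ ys) ≡ sumℚ xs + sumℚ ys
sumℚ-++ [] ys = sym (ℚ.+-identityˡ _)
sumℚ-++ (x ∷ xs) ys = ≡-trans (cong (λ z → x + z) (sumℚ-++ xs ys)) (sym (ℚ.+-assoc x _ _))

module _ {A : Set} where

  sumℚ-cong : ∀ (xs : List A) {f g : A → ℚ} → f ≗ g → sumℚ (map f xs) ≡ sumℚ (map g xs)
  sumℚ-cong [] f≗g = refl
  sumℚ-cong (x ∷ xs) f≗g = cong₂ _+_ (f≗g x) (sumℚ-cong xs f≗g)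

  sumℚ-mono-≤ : ∀ (xs : List A) {f g : A → ℚ} → (∀ x → f x ≤ g x) → sumℚ (map f xs) ≤ sumℚ (map g xs)
  sumℚ-mono-≤ [] f≤g = ≤-refl
  sumℚ-mono-≤ (x ∷ xs) f≤g = +-mono-≤ (f≤g x) (sumℚ-mono-≤ xs f≤g)

  0≤sumℚ : ∀ (xs : List A) {f : A → ℚ} → (∀ x → 0ℚ ≤ f x) → 0ℚ ≤ sumℚ (map f xs)
  0≤sumℚ [] 0≤f = ≤-refl
  0≤sumℚ (x ∷ xs) 0≤f = +-mono-≤ (0≤f x) (0≤sumℚ xs 0≤f)

  sumℚ-zero : ∀ (xs : List A) → sumℚ (map (λ _ → 0ℚ) xs) ≡ 0ℚ
  sumℚ-zero [] = refl
  sumℚ-zero (x ∷ xs) = ≡-trans (cong (λ z → 0ℚ + z) (sumℚ-zero xs)) (ℚ.+-identityˡ 0ℚ)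

  sumℚ-+ : ∀ (xs : List A) (f g : A → ℚ) →
    sumℚ (map (λ x → f x + g x) xs) ≡ sumℚ (map f xs) + sumℚ (map g xs)
  sumℚ-+ [] f g = refl
  sumℚ-+ (x ∷ xs) f g = ≡-trans (cong (λ z → (f x + g x) + z) (sumℚ-+ xs f g))
    (interchange (f x) (g x) (sumℚ (map f xs)) (sumℚ (map g xs)))
    where
    interchange : ∀ a b c d → a + b + (c + d) ≡ a + c + (b + d)
    interchange = solve 4 (λ a b c d → a :+ b :+ (c :+ d) := a :+ c :+ (b :+ d)) refl

  sumℚ-*ˡ : ∀ (xs : List A) (c : ℚ) (f : A → ℚ) → sumℚ (map (λ x → c * f x) xs) ≡ c * sumℚ (map f xs)
  sumℚ-*ˡ [] c f = sym (ℚ.*-zeroʳ c)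
  sumℚ-*ˡ (x ∷ xs) c f =
    ≡-trans (cong (λ z → c * f x + z) (sumℚ-*ˡ xs c f)) (sym (ℚ.*-distribˡ-+ c (f x) _))

  sumℚ-*ʳ : ∀ (xs : List A) (c : ℚ) (f : A → ℚ) → sumℚ (map (λ x → f x * c) xs) ≡ sumℚ (map f xs) * c
  sumℚ-*ʳ xs c f = ≡-trans (sumℚ-cong xs (λ x → ℚ.*-comm (f x) c)) (≡-trans (sumℚ-*ˡ xs c f) (ℚ.*-comm c _))

module _ {A B : Set} where

  sumℚ-swap : ∀ (xs : List A) (ys : List B) (f : A → B → ℚ) →
    sumℚ (map (λ x → sumℚ (map (f x) ys)) xs) ≡ sumℚ (map (λ y → sumℚ (map (λ x → f x y) xs)) ys)
  sumℚ-swap [] ys f = sym (sumℚ-zero ys)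
  sumℚ-swap (x ∷ xs) ys f = ≡-trans (cong (λ z → sumℚ (map (f x) ys) + z) (sumℚ-swap xs ys f))
    (sym (sumℚ-+ ys (f x) (λ y → sumℚ (map (λ x → f x y) xs))))

  sumℚ-concatMap : ∀ (xs : List A) (h : A → List B) (g : B → ℚ) →
    sumℚ (map g (concatMap h xs)) ≡ sumℚ (map (λ x → sumℚ (map g (h x))) xs)
  sumℚ-concatMap [] h g = refl
  sumℚ-concatMap (x ∷ xs) h g = begin
    sumℚ (map g (h x ++ concatMap h xs))                 ≡⟨ cong sumℚ (List.map-++ g (h x) (concatMap h xs)) ⟩
    sumℚ (map g (h x) ++ map g (concatMap h xs))         ≡⟨ sumℚ-++ (map g (h x)) _ ⟩
    sumℚ (map g (h x)) + sumℚ (map g (concatMap h xs))   ≡⟨ cong (λ z → sumℚ (map g (h x)) + z) (sumℚ-concatMap xs h g) ⟩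
    sumℚ (map g (h x)) + sumℚ (map (λ x → sumℚ (map g (h x))) xs) ∎
    where open ≡-Reasoning

sumFin : ∀ {n} → (Fin n → ℚ) → ℚ
sumFin {zero} f = 0ℚ
sumFin {suc n} f = f zero + sumFin (λ i → f (suc i))

prodFin : ∀ {n} → (Fin n → ℚ) → ℚ
prodFin {zero} f = 1ℚ
prodFin {suc n} f = f zero * prodFin (λ i → f (suc i))

private
  prodℚ-tabulate : ∀ {n} (f : Fin n → ℚ) → prodℚ (tabulate f) ≡ prodFin f
  prodℚ-tabulate {zero} f = refl
  prodℚ-tabulate {suc n} f = cong (λ z → f zero * z) (prodℚ-tabulate (λ i → f (suc i)))

prodℚ-allFin : ∀ {n} (f : Fin n → ℚ) → prodℚ (map f (allFin n)) ≡ prodFin f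
prodℚ-allFin f = ≡-trans (cong prodℚ (List.map-tabulate id f)) (prodℚ-tabulate f)

sumFin-cong : ∀ {n} {f g : Fin n → ℚ} → f ≗ g → sumFin f ≡ sumFin g
sumFin-cong {zero} f≗g = refl
sumFin-cong {suc n} f≗g = cong₂ _+_ (f≗g zero) (sumFin-cong (λ i → f≗g (suc i)))

prodFin-cong : ∀ {n} {f g : Fin n → ℚ} → f ≗ g → prodFin f ≡ prodFin g
prodFin-cong {zero} f≗g = refl
prodFin-cong {suc n} f≗g = cong₂ _*_ (f≗g zero) (prodFin-cong (λ i → f≗g (suc i)))

sumFin-mono-≤ : ∀ {n} {f g : Fin n → ℚ} → (∀ i → f i ≤ g i) → sumFin f ≤ sumFin g
sumFin-mono-≤ {zero} f≤g = ≤-refl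
sumFin-mono-≤ {suc n} f≤g = +-mono-≤ (f≤g zero) (sumFin-mono-≤ (λ i → f≤g (suc i)))

sumFin-+ : ∀ {n} (f g : Fin n → ℚ) → sumFin (λ i → f i + g i) ≡ sumFin f + sumFin g
sumFin-+ {zero} f g = refl
sumFin-+ {suc n} f g =
  ≡-trans (cong (λ z → (f zero + g zero) + z) (sumFin-+ (λ i → f (suc i)) (λ i → g (suc i))))
    (interchange (f zero) (g zero) _ _)
  where
  interchange : ∀ a b c d → a + b + (c + d) ≡ a + c + (b + d)
  interchange = solve 4 (λ a b c d → a :+ b :+ (c :+ d) := a :+ c :+ (b :+ d)) refl

sumFin-const : ∀ n (c : ℚ) → sumFin {n} (λ _ → c) ≡ fromℕ n * c
sumFin-const zero c = sym (ℚ.*-zeroˡ c)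
sumFin-const (suc n) c = begin
  c + sumFin {n} (λ _ → c)   ≡⟨ cong (λ z → c + z) (sumFin-const n c) ⟩
  c + fromℕ n * c            ≡⟨ distrib c (fromℕ n) ⟩
  (1ℚ + fromℕ n) * c         ≡⟨ cong (_* c) (sym (fromℕ-suc n)) ⟩
  fromℕ (suc n) * c          ∎
  where
  open ≡-Reasoning
  distrib : ∀ c x → c + x * c ≡ (1ℚ + x) * c
  distrib = solve 2 (λ c x → c :+ x :* c := (con 1ℚ :+ x) :* c) refl

prodFin-1 : ∀ n → prodFin {n} (λ _ → 1ℚ) ≡ 1ℚ
prodFin-1 zero = refl
prodFin-1 (suc n) = cong (1ℚ *_) (prodFin-1 n)

0≤prodFin : ∀ {n} (f : Fin n → ℚ) → (∀ i → 0ℚ ≤ f i) → 0ℚ ≤ prodFin f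
0≤prodFin {zero} f 0≤f = 0≤1
0≤prodFin {suc n} f 0≤f = 0≤* (0≤f zero) (0≤prodFin (λ i → f (suc i)) (λ i → 0≤f (suc i)))

prodFin≤1 : ∀ {n} (f : Fin n → ℚ) → (∀ i → 0ℚ ≤ f i) → (∀ i → f i ≤ 1ℚ) → prodFin f ≤ 1ℚ
prodFin≤1 {zero} f 0≤f f≤1 = ≤-refl
prodFin≤1 {suc n} f 0≤f f≤1 = begin
  f zero * prodFin f′   ≤⟨ *-monoʳ-≤-0≤ (0≤prodFin f′ (λ i → 0≤f (suc i))) (f≤1 zero) ⟩
  1ℚ * prodFin f′       ≡⟨ ℚ.*-identityˡ _ ⟩
  prodFin f′            ≤⟨ prodFin≤1 f′ (λ i → 0≤f (suc i)) (λ i → f≤1 (suc i)) ⟩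
  1ℚ                    ∎
  where
  open ℚ.≤-Reasoning
  f′ = λ i → f (suc i)

𝟙 : Bool → ℚ
𝟙 b = if b then 1ℚ else 0ℚ

0≤𝟙 : ∀ b → 0ℚ ≤ 𝟙 b
0≤𝟙 true = 0≤1
0≤𝟙 false = ≤-refl

𝟙≤1 : ∀ b → 𝟙 b ≤ 1ℚ
𝟙≤1 true = ≤-refl
𝟙≤1 false = 0≤1

∣_∣ : ∀ {n} → (Fin n → Bool) → ℕ
∣_∣ {zero} P = 0
∣_∣ {suc n} P = (if P zero then 1 else 0) ℕ.+ ∣ (λ i → P (suc i)) ∣

private
  length-filter-tabulate : ∀ {n m} (f : Fin n → Fin m) (P : Fin m → Bool) →
    length (filter (λ v → P v Bool.≟ true) (tabulate f)) ≡ ∣ (λ i → P (f i)) ∣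
  length-filter-tabulate {zero} f P = refl
  length-filter-tabulate {suc n} f P with P (f zero)
  ... | true = cong suc (length-filter-tabulate (λ i → f (suc i)) P)
  ... | false = length-filter-tabulate (λ i → f (suc i)) P

count≡∣∣ : ∀ {n} (P : Fin n → Bool) → count P ≡ ∣ P ∣
count≡∣∣ P = length-filter-tabulate id P

sumFin-𝟙 : ∀ {n} (P : Fin n → Bool) → sumFin (λ i → 𝟙 (P i)) ≡ fromℕ ∣ P ∣
sumFin-𝟙 {zero} P = refl
sumFin-𝟙 {suc n} P with P zero
... | true = ≡-trans (cong (λ z → 1ℚ + z) (sumFin-𝟙 (λ i → P (suc i)))) (sym (fromℕ-suc ∣ (λ i → P (suc i)) ∣))
... | false = ≡-trans (cong (λ z → 0ℚ + z) (sumFin-𝟙 (λ i → P (suc i)))) (ℚ.+-identityˡ _)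

∣∣-cong : ∀ {n} {P Q : Fin n → Bool} → P ≗ Q → ∣ P ∣ ≡ ∣ Q ∣
∣∣-cong {zero} P≗Q = refl
∣∣-cong {suc n} P≗Q =
  cong₂ (λ a b → (if a then 1 else 0) ℕ.+ b) (P≗Q zero) (∣∣-cong (λ i → P≗Q (suc i)))

∣∣≤n : ∀ {n} (P : Fin n → Bool) → ∣ P ∣ ℕ.≤ n
∣∣≤n {zero} P = z≤n
∣∣≤n {suc n} P with P zero
... | true = s≤s (∣∣≤n (λ i → P (suc i)))
... | false = ℕ.m≤n⇒m≤1+n (∣∣≤n (λ i → P (suc i)))

∣∣≤n-missing : ∀ {n} (P : Fin (suc n) → Bool) (w : Fin (suc n)) → P w ≡ false → ∣ P ∣ ℕ.≤ n
∣∣≤n-missing P zero Pw≡false rewrite Pw≡false = ∣∣≤n (λ i → P (suc i))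
∣∣≤n-missing {suc n} P (suc w) Pw≡false with P zero
... | true = s≤s (∣∣≤n-missing (λ i → P (suc i)) w Pw≡false)
... | false = ℕ.m≤n⇒m≤1+n (∣∣≤n-missing (λ i → P (suc i)) w Pw≡false)

∣full∣ : ∀ n → ∣ full {n} ∣ ≡ n
∣full∣ zero = refl
∣full∣ (suc n) = cong suc (∣full∣ n)

∣∅∣ : ∀ n → ∣ (λ (_ : Fin n) → false) ∣ ≡ 0
∣∅∣ zero = refl
∣∅∣ (suc n) = ∣∅∣ n

isYes-suc≟suc : ∀ {m} (u v : Fin m) → isYes (suc u ≟ suc v) ≡ isYes (u ≟ v)
isYes-suc≟suc u v with u ≟ v
... | true because _ = refl
... | false because _ = refl

∣single∣ : ∀ {m} (v : Fin m) → ∣ single v ∣ ≡ 1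
∣single∣ {suc m} zero = cong suc (∣∅∣ m)
∣single∣ {suc m} (suc v) = ≡-trans (∣∣-cong (λ i → isYes-suc≟suc i v)) (∣single∣ v)

∣others∣ : ∀ {m} (u : Fin (suc m)) → ∣ (λ v → not (isYes (u ≟ v))) ∣ ≡ m
∣others∣ {m} zero = ∣full∣ m
∣others∣ {suc m} (suc u) = cong suc (≡-trans (∣∣-cong (λ i → cong not (isYes-suc≟suc u i))) (∣others∣ u))

self-or-other : ∀ {m} (u v : Fin m) → (isYes (v ≟ u) ∨ not (isYes (u ≟ v))) ≡ true
self-or-other zero zero = refl
self-or-other zero (suc v) = refl
self-or-other (suc u) zero = refl
self-or-other (suc u) (suc v) rewrite isYes-suc≟suc u v | isYes-suc≟suc v u = self-or-other u v

⋀ : ∀ {n} → (Fin n → Bool) → Bool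
⋀ {zero} f = true
⋀ {suc n} f = f zero ∧ ⋀ (λ i → f (suc i))

private
  foldr-∧-tabulate : ∀ {n} (f : Fin n → Bool) → foldr _∧_ true (tabulate f) ≡ ⋀ f
  foldr-∧-tabulate {zero} f = refl
  foldr-∧-tabulate {suc n} f = cong (f zero ∧_) (foldr-∧-tabulate (λ i → f (suc i)))

  ⋀-cong : ∀ {n} {f g : Fin n → Bool} → f ≗ g → ⋀ f ≡ ⋀ g
  ⋀-cong {zero} f≗g = refl
  ⋀-cong {suc n} f≗g = cong₂ _∧_ (f≗g zero) (⋀-cong (λ i → f≗g (suc i)))

  ⋀-true : ∀ {n} (f : Fin n → Bool) → ⋀ f ≡ true → ∀ i → f i ≡ true
  ⋀-true {suc n} f ⋀f with f zero in f0
  ⋀-true {suc n} f ⋀f | true = λ { zero → f0 ; (suc i) → ⋀-true (λ i → f (suc i)) ⋀f i }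

  𝟙-⋀ : ∀ {n} (f : Fin n → Bool) → 𝟙 (⋀ f) ≡ prodFin (λ i → 𝟙 (f i))
  𝟙-⋀ {zero} f = refl
  𝟙-⋀ {suc n} f with f zero
  ... | true = ≡-trans (𝟙-⋀ (λ i → f (suc i))) (sym (ℚ.*-identityˡ _))
  ... | false = sym (ℚ.*-zeroˡ (prodFin (λ i → 𝟙 (f (suc i)))))

  isYes-≟-sound : ∀ (a b : Bool) → isYes (a Bool.≟ b) ≡ true → a ≡ b
  isYes-≟-sound false false _ = refl
  isYes-≟-sound true true _ = refl

eqSet≡⋀ : ∀ {n} (A B : VSet n) → eqSet A B ≡ ⋀ (λ i → isYes (A i Bool.≟ B i))
eqSet≡⋀ A B = ≡-trans (cong (foldr _∧_ true) (List.map-tabulate id A≟B)) (foldr-∧-tabulate A≟B)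
  where
  A≟B = λ i → isYes (A i Bool.≟ B i)

eqSet-congˡ : ∀ {n} {A A′ : VSet n} (B : VSet n) → A ≗ A′ → eqSet A B ≡ eqSet A′ B
eqSet-congˡ {A = A} {A′} B A≗A′ = ≡-trans (eqSet≡⋀ A B)
  (≡-trans (⋀-cong (λ i → cong (λ z → isYes (z Bool.≟ B i)) (A≗A′ i))) (sym (eqSet≡⋀ A′ B)))

eqSet-sound : ∀ {n} (A B : VSet n) → eqSet A B ≡ true → A ≗ B
eqSet-sound A B eq i =
  isYes-≟-sound (A i) (B i) (⋀-true (λ i → isYes (A i Bool.≟ B i)) (≡-trans (sym (eqSet≡⋀ A B)) eq) i)

𝟙-eqSet : ∀ {n} (A B : VSet n) → 𝟙 (eqSet A B) ≡ prodFin (λ i → 𝟙 (isYes (A i Bool.≟ B i)))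
𝟙-eqSet A B = ≡-trans (cong 𝟙 (eqSet≡⋀ A B)) (𝟙-⋀ (λ i → isYes (A i Bool.≟ B i)))

-- Product measures on vertex sets

sumSets : ∀ {n} → (VSet n → ℚ) → ℚ
sumSets {n} g = sumℚ (map g (allSets n))

Extensional : ∀ {n} → (VSet n → ℚ) → Set
Extensional g = ∀ {S S′} → S ≗ S′ → g S ≡ g S′

_◃_ : ∀ {n} → Bool → VSet n → VSet (suc n)
(b ◃ S) zero = b
(b ◃ S) (suc i) = S i

sumSets-cong : ∀ {n} {g h : VSet n → ℚ} → g ≗ h → sumSets g ≡ sumSets h
sumSets-cong {n} = sumℚ-cong (allSets n)

sumSets-suc : ∀ {n} (g : VSet (suc n) → ℚ) → Extensional g →
  sumSets g ≡ sumSets (λ S → g (false ◃ S) + g (true ◃ S))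
sumSets-suc {n} g ext = ≡-trans (sumℚ-concatMap (allSets n) _ g) (sumℚ-cong (allSets n) (λ S →
  ≡-trans (cong (λ z → g _ + z) (ℚ.+-identityʳ _))
          (cong₂ _+_ (ext λ { zero → refl ; (suc i) → refl }) (ext λ { zero → refl ; (suc i) → refl }))))

product : ∀ {n} → (Fin n → Bool → ℚ) → VSet n → ℚ
product f S = prodFin (λ w → f w (S w))

product-ext : ∀ {n} (f : Fin n → Bool → ℚ) → Extensional (product f)
product-ext f S≗S′ = prodFin-cong (λ w → cong (f w) (S≗S′ w))

Normalised : ∀ {n} → (Fin n → Bool → ℚ) → Set
Normalised f = ∀ w → f w false + f w true ≡ 1ℚ

sumSets-product : ∀ n (f : Fin n → Bool → ℚ) → sumSets (product f) ≡ prodFin (λ w → f w false + f w true)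
sumSets-product zero f = ℚ.+-identityʳ _
sumSets-product (suc n) f = begin
  sumSets (product f)
    ≡⟨ sumSets-suc (product f) (product-ext f) ⟩
  sumSets (λ S → f zero false * product f′ S + f zero true * product f′ S)
    ≡⟨ sumSets-cong (λ S → sym (ℚ.*-distribʳ-+ (product f′ S) (f zero false) (f zero true))) ⟩
  sumSets (λ S → (f zero false + f zero true) * product f′ S)
    ≡⟨ sumℚ-*ˡ (allSets n) (f zero false + f zero true) (product f′) ⟩
  (f zero false + f zero true) * sumSets (product f′)
    ≡⟨ cong (λ z → (f zero false + f zero true) * z) (sumSets-product n f′) ⟩
  prodFin (λ w → f w false + f w true)
    ∎
  where
  open ≡-Reasoning
  f′ = λ i → f (suc i)

sumSets-product-normalised : ∀ n (f : Fin n → Bool → ℚ) → Normalised f → sumSets (product f) ≡ 1ℚ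
sumSets-product-normalised n f norm = ≡-trans (sumSets-product n f) (≡-trans (prodFin-cong norm) (prodFin-1 n))

private
  sumSets-product-sumFin : ∀ n (f : Fin n → Bool → ℚ) → Normalised f →
    sumSets (λ S → product f S * sumFin (λ i → 𝟙 (S i))) ≡ sumFin (λ w → f w true)
  sumSets-product-sumFin zero f norm = ℚ.+-identityʳ _
  sumSets-product-sumFin (suc n) f norm = begin
    sumSets (λ S → product f S * size S)
      ≡⟨ sumSets-suc _ (λ S≗S′ → cong₂ _*_ (product-ext f S≗S′) (sumFin-cong (λ i → cong 𝟙 (S≗S′ i)))) ⟩
    sumSets (λ S → a * product f′ S * (0ℚ + size S) + b * product f′ S * (1ℚ + size S))
      ≡⟨ sumSets-cong (λ S → split a b (product f′ S) (size S) (norm zero)) ⟩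
    sumSets (λ S → product f′ S * size S + b * product f′ S)
      ≡⟨ sumℚ-+ (allSets n) (λ S → product f′ S * size S) (λ S → b * product f′ S) ⟩
    sumSets (λ S → product f′ S * size S) + sumSets (λ S → b * product f′ S)
      ≡⟨ cong₂ _+_ (sumSets-product-sumFin n f′ (λ w → norm (suc w))) (sumℚ-*ˡ (allSets n) b (product f′)) ⟩
    sumFin (λ w → f′ w true) + b * sumSets (product f′)
      ≡⟨ cong (λ z → sumFin (λ w → f′ w true) + b * z) (sumSets-product-normalised n f′ (λ w → norm (suc w))) ⟩
    sumFin (λ w → f′ w true) + b * 1ℚ
      ≡⟨ ℚ.+-comm _ (b * 1ℚ) ⟩
    b * 1ℚ + sumFin (λ w → f′ w true)
      ≡⟨ cong (λ z → z + sumFin (λ w → f′ w true)) (ℚ.*-identityʳ b) ⟩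
    sumFin (λ w → f w true)
      ∎
    where
    open ≡-Reasoning
    f′ = λ i → f (suc i)
    a = f zero false
    b = f zero true
    size : ∀ {m} → VSet m → ℚ
    size S = sumFin (λ i → 𝟙 (S i))
    split : ∀ a b P c → a + b ≡ 1ℚ → a * P * (0ℚ + c) + b * P * (1ℚ + c) ≡ P * c + b * P
    split a b P c a+b≡1 = ≡-trans (expand a b P c)
      (≡-trans (cong (λ z → z * (P * c) + b * P) a+b≡1) (cong (_+ b * P) (ℚ.*-identityˡ (P * c))))
      where
      expand : ∀ a b P c → a * P * (0ℚ + c) + b * P * (1ℚ + c) ≡ (a + b) * (P * c) + b * P
      expand = solve 4 (λ a b P c →
        a :* P :* (con 0ℚ :+ c) :+ b :* P :* (con 1ℚ :+ c) := (a :+ b) :* (P :* c) :+ b :* P) refl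

sumSets-product-size : ∀ n (f : Fin n → Bool → ℚ) → Normalised f →
  sumSets (λ S → product f S * fromℕ ∣ S ∣) ≡ sumFin (λ w → f w true)
sumSets-product-size n f norm = ≡-trans
  (sumSets-cong (λ S → cong (product f S *_) (sym (sumFin-𝟙 S)))) (sumSets-product-sumFin n f norm)

≤-sumSets-full : ∀ n (g : VSet n → ℚ) → Extensional g → (∀ S → 0ℚ ≤ g S) → g full ≤ sumSets g
≤-sumSets-full zero g ext 0≤g = ≤-reflexive (≡-trans (ext (λ ())) (sym (ℚ.+-identityʳ _)))
≤-sumSets-full (suc n) g ext 0≤g = begin
  g full                                        ≡⟨ ext (λ { zero → refl ; (suc i) → refl }) ⟩
  g (true ◃ full)                               ≤⟨ ≤-sumSets-full n (λ S → g (true ◃ S)) ext′ (λ S → 0≤g _) ⟩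
  sumSets (λ S → g (true ◃ S))                  ≤⟨ sumℚ-mono-≤ (allSets n) (λ S → ≤0+ (0≤g (false ◃ S))) ⟩
  sumSets (λ S → g (false ◃ S) + g (true ◃ S))  ≡⟨ sym (sumSets-suc g ext) ⟩
  sumSets g                                     ∎
  where
  open ℚ.≤-Reasoning
  ext′ : Extensional (λ S → g (true ◃ S))
  ext′ S≗S′ = ext (λ { zero → refl ; (suc i) → S≗S′ i })
  ≤0+ : ∀ {p q} → 0ℚ ≤ p → q ≤ p + q
  ≤0+ {p} {q} 0≤p = ≤-trans (≤+0≤ 0≤p) (≤-reflexive (ℚ.+-comm q p))

exceeds : ∀ {n} → ℕ → VSet n → ℚ
exceeds M B = 𝟙 (isYes (M ℕ.<? ∣ B ∣))

≤-𝟙+ : ∀ {A : Set} (d : Dec A) {x ε} → 0ℚ ≤ ε → x ≤ 1ℚ → (¬ A → x ≤ ε) → x ≤ 𝟙 (isYes d) + ε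
≤-𝟙+ (yes _) 0≤ε x≤1 _ = ≤-trans x≤1 (≤+0≤ 0≤ε)
≤-𝟙+ (no ¬a) {ε = ε} _ _ x≤ε = ≤-trans (x≤ε ¬a) (≤-reflexive (sym (ℚ.+-identityˡ ε)))

exceeds-ext : ∀ {n} M → Extensional {n} (exceeds M)
exceeds-ext M S≗S′ = cong (λ z → 𝟙 (isYes (M ℕ.<? z))) (∣∣-cong S≗S′)

M*exceeds≤∣∣ : ∀ {n} M (B : VSet n) → fromℕ M * exceeds M B ≤ fromℕ ∣ B ∣
M*exceeds≤∣∣ M B with M ℕ.<? ∣ B ∣
... | yes M<∣B∣ = ≤-trans (≤-reflexive (ℚ.*-identityʳ (fromℕ M))) (fromℕ-mono-≤ (ℕ.<⇒≤ M<∣B∣))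
... | no _ = ≤-trans (≤-reflexive (ℚ.*-zeroʳ (fromℕ M))) (0≤fromℕ ∣ B ∣)

exceeds-full : ∀ n M → M ℕ.< n → exceeds M (full {n}) ≡ 1ℚ
exceeds-full n M M<n with M ℕ.<? ∣ full {n} ∣
... | yes _ = refl
... | no M≮∣full∣ = ⊥-elim (M≮∣full∣ (subst (M ℕ.<_) (sym (∣full∣ n)) M<n))

exceeds-singleton : ∀ {n} (B : VSet n) → ∣ B ∣ ≡ 1 → exceeds 1 B ≡ 0ℚ
exceeds-singleton B ∣B∣≡1 rewrite ∣B∣≡1 = refl

s+2s²≤3m² : ∀ {c m} → c ℕ.≤ m → 1 ℕ.≤ m →
  let s = fromℕ c in s + (s * s + s * s) ≤ fromℕ (3 ℕ.* (m ℕ.* m))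
s+2s²≤3m² {c} {m} c≤m 1≤m = ≤-trans (≤-reflexive (sym embed)) (fromℕ-mono-≤ bound)
  where
  embed : fromℕ (c ℕ.+ (c ℕ.* c ℕ.+ c ℕ.* c)) ≡ fromℕ c + (fromℕ c * fromℕ c + fromℕ c * fromℕ c)
  embed = ≡-trans (fromℕ-+ c _) (cong (λ z → fromℕ c + z)
            (≡-trans (fromℕ-+ (c ℕ.* c) (c ℕ.* c)) (cong₂ _+_ (fromℕ-* c c) (fromℕ-* c c))))
  c≤m*m : c ℕ.≤ m ℕ.* m
  c≤m*m = ℕ.≤-trans c≤m (ℕ.m≤m*n m m {{ℕ.>-nonZero 1≤m}})
  bound : c ℕ.+ (c ℕ.* c ℕ.+ c ℕ.* c) ℕ.≤ 3 ℕ.* (m ℕ.* m)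
  bound = subst (λ z → c ℕ.+ (c ℕ.* c ℕ.+ c ℕ.* c) ℕ.≤ m ℕ.* m ℕ.+ (m ℕ.* m ℕ.+ z)) (sym (ℕ.+-identityʳ (m ℕ.* m)))
            (ℕ.+-mono-≤ c≤m*m (ℕ.+-mono-≤ (ℕ.*-mono-≤ c≤m c≤m) (ℕ.*-mono-≤ c≤m c≤m)))

-- One round on the complete graph

∣∧∣≤∣∣ : ∀ {n} (P Q : Fin n → Bool) → ∣ (λ i → P i ∧ Q i) ∣ ℕ.≤ ∣ P ∣
∣∧∣≤∣∣ {zero} P Q = z≤n
∣∧∣≤∣∣ {suc n} P Q with P zero | Q zero
... | true | true = s≤s (∣∧∣≤∣∣ (λ i → P (suc i)) (λ i → Q (suc i)))
... | true | false = ℕ.m≤n⇒m≤1+n (∣∧∣≤∣∣ (λ i → P (suc i)) (λ i → Q (suc i)))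
... | false | _ = ∣∧∣≤∣∣ (λ i → P (suc i)) (λ i → Q (suc i))

miss : Bool → ℚ → ℚ
miss b x = if b then 1ℚ - x else 1ℚ

0≤miss : ∀ b {x} → x ≤ 1ℚ → 0ℚ ≤ miss b x
0≤miss true x≤1 = 0≤1- x≤1
0≤miss false x≤1 = 0≤1

miss≤1 : ∀ b {x} → 0ℚ ≤ x → miss b x ≤ 1ℚ
miss≤1 true 0≤x = 1- 0≤x ≤1
miss≤1 false 0≤x = ≤-refl

union-bound : ∀ {m} (c : Fin m → Bool) (x : ℚ) → 0ℚ ≤ x → x ≤ 1ℚ →
  1ℚ - prodFin (λ u → miss (c u) x) ≤ fromℕ ∣ c ∣ * x
union-bound {zero} c x 0≤x x≤1 = ≤-reflexive (≡-trans (ℚ.+-inverseʳ 1ℚ) (sym (ℚ.*-zeroˡ x)))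
union-bound {suc m} c x 0≤x x≤1 with c zero
... | true = begin
  1ℚ - (1ℚ - x) * R                  ≡⟨ expand x R ⟩
  x * R + (1ℚ - R)                   ≤⟨ +-mono-≤ x*R≤x (union-bound c′ x 0≤x x≤1) ⟩
  x + fromℕ ∣ c′ ∣ * x               ≡⟨ collect x (fromℕ ∣ c′ ∣) ⟩
  (1ℚ + fromℕ ∣ c′ ∣) * x            ≡⟨ cong (_* x) (sym (fromℕ-suc ∣ c′ ∣)) ⟩
  fromℕ (suc ∣ c′ ∣) * x             ∎
  where
  open ℚ.≤-Reasoning
  c′ = λ i → c (suc i)
  R = prodFin (λ u → miss (c′ u) x)
  x*R≤x : x * R ≤ x
  x*R≤x = ≤-trans (*-monoˡ-≤-0≤ 0≤x (prodFin≤1 _ (λ u → 0≤miss (c′ u) x≤1) (λ u → miss≤1 (c′ u) 0≤x)))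
                  (≤-reflexive (ℚ.*-identityʳ x))
  expand : ∀ x R → 1ℚ - (1ℚ - x) * R ≡ x * R + (1ℚ - R)
  expand = solve 2 (λ x R → con 1ℚ :- (con 1ℚ :- x) :* R := x :* R :+ (con 1ℚ :- R)) refl
  collect : ∀ x C → x + C * x ≡ (1ℚ + C) * x
  collect = solve 2 (λ x C → x :+ C :* x := (con 1ℚ :+ C) :* x) refl
... | false = ≤-trans (≤-reflexive (cong (1ℚ -_) (ℚ.*-identityˡ (prodFin (λ u → miss (c′ u) x)))))
                      (union-bound c′ x 0≤x x≤1)
  where
  c′ = λ i → c (suc i)

-- law a b s: probability that a vertex of colour a (true = blue) has colour b after a round
-- in which, while white, it stays white with probability s.
law : Bool → Bool → ℚ → ℚ
law true b s = 𝟙 b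
law false true s = 1ℚ - s
law false false s = s

law-normalised : ∀ a s → law a false s + law a true s ≡ 1ℚ
law-normalised true s = ℚ.+-identityˡ 1ℚ
law-normalised false s = solve 1 (λ s → s :+ (con 1ℚ :- s) := con 1ℚ) refl s

0≤law : ∀ a b {s} → (a ≡ false → 0ℚ ≤ s × s ≤ 1ℚ) → 0ℚ ≤ law a b s
0≤law true b _ = 0≤𝟙 b
0≤law false true s-bounds = 0≤1- (proj₂ (s-bounds refl))
0≤law false false s-bounds = proj₁ (s-bounds refl)

law-true≤ : ∀ a {s x} → 0ℚ ≤ x → (a ≡ false → 1ℚ - s ≤ x) → law a true s ≤ 𝟙 a + x
law-true≤ true 0≤x _ = ≤+0≤ 0≤x
law-true≤ false {x = x} _ 1-s≤x = ≤-trans (1-s≤x refl) (≤-reflexive (sym (ℚ.+-identityˡ x)))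

module CompleteGraph (k : ℕ) where

  n : ℕ
  n = suc (suc k)

  deg-K : ∀ u → deg (K n) u ≡ suc k
  deg-K u = ≡-trans (count≡∣∣ (K n u)) (∣others∣ u)

  closedBlue-K : ∀ B u → closedBlue (K n) B u ≡ ∣ B ∣
  closedBlue-K B u = ≡-trans (count≡∣∣ (λ v → (isYes (v ≟ u) ∨ K n u v) ∧ B v))
                             (∣∣-cong (λ v → cong (_∧ B v) (self-or-other u v)))

  p : VSet n → ℚ
  p B = (+ ∣ B ∣) / suc k

  fireProb-K : ∀ B u → fireProb (K n) B u ≡ p B
  fireProb-K B u with deg (K n) u | deg-K u
  ... | .(suc k) | refl = cong (λ z → (+ z) / suc k) (closedBlue-K B u)

  r : ℚ
  r = fromℕ (suc k)

  instance
    r-positive : Positive r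
    r-positive = fromℕ-pos {suc k} (s≤s z≤n)

  p*r : ∀ B → p B * r ≡ fromℕ ∣ B ∣
  p*r B = /-*-fromℕ ∣ B ∣ k

  0≤p : ∀ B → 0ℚ ≤ p B
  0≤p B = *-cancelʳ-≤-pos r (≤-trans (≤-reflexive (ℚ.*-zeroˡ r)) (subst (0ℚ ≤_) (sym (p*r B)) (0≤fromℕ ∣ B ∣)))

  p≤1 : ∀ B → ∣ B ∣ ℕ.≤ suc k → p B ≤ 1ℚ
  p≤1 B ∣B∣≤ = *-cancelʳ-≤-pos r
    (≤-trans (≤-reflexive (p*r B)) (≤-trans (fromℕ-mono-≤ ∣B∣≤) (≤-reflexive (sym (ℚ.*-identityˡ r)))))

  stayWhite-K : ∀ B w → stayWhite (K n) B w ≡ prodFin (λ u → miss (B u ∧ K n u w) (p B))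
  stayWhite-K B w = ≡-trans (prodℚ-allFin (λ u → miss (c u) (fireProb (K n) B u)))
                            (prodFin-cong (λ u → cong (miss (c u)) (fireProb-K B u)))
    where
    c = λ u → B u ∧ K n u w

  stayWhite-bounds : ∀ B w → B w ≡ false → 0ℚ ≤ stayWhite (K n) B w × stayWhite (K n) B w ≤ 1ℚ
  stayWhite-bounds B w Bw≡false =
      subst (0ℚ ≤_) (sym (stayWhite-K B w)) (0≤prodFin (λ u → miss (c u) (p B)) (λ u → 0≤miss (c u) p≤1′))
    , subst (_≤ 1ℚ) (sym (stayWhite-K B w))
        (prodFin≤1 (λ u → miss (c u) (p B)) (λ u → 0≤miss (c u) p≤1′) (λ u → miss≤1 (c u) (0≤p B)))
    where
    c = λ u → B u ∧ K n u w
    p≤1′ = p≤1 B (∣∣≤n-missing B w Bw≡false)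

  roundLaw : VSet n → Fin n → Bool → ℚ
  roundLaw B w b = law (B w) b (stayWhite (K n) B w)

  trans-K : ∀ B B′ → trans (K n) B B′ ≡ product (roundLaw B) B′
  trans-K B B′ = ≡-trans (prodℚ-allFin (λ w → if B w then (if B′ w then 1ℚ else 0ℚ)
      else (if B′ w then 1ℚ - stayWhite (K n) B w else stayWhite (K n) B w)))
    (prodFin-cong (λ w → if≡law (B w) (B′ w) (stayWhite (K n) B w)))
    where
    if≡law : ∀ a b s → (if a then (if b then 1ℚ else 0ℚ) else (if b then 1ℚ - s else s)) ≡ law a b s
    if≡law true b s = refl
    if≡law false true s = refl
    if≡law false false s = refl

  0≤roundLaw : ∀ B w b → 0ℚ ≤ roundLaw B w b
  0≤roundLaw B w b = 0≤law (B w) b (stayWhite-bounds B w)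

  roundLaw-normalised : ∀ B → Normalised (roundLaw B)
  roundLaw-normalised B w = law-normalised (B w) (stayWhite (K n) B w)

  0≤trans : ∀ B B′ → 0ℚ ≤ trans (K n) B B′
  0≤trans B B′ = subst (0ℚ ≤_) (sym (trans-K B B′)) (0≤prodFin _ (λ w → 0≤roundLaw B w (B′ w)))

  trans-ext : ∀ B → Extensional (trans (K n) B)
  trans-ext B {S} {S′} S≗S′ = ≡-trans (trans-K B S) (≡-trans (product-ext (roundLaw B) S≗S′) (sym (trans-K B S′)))

  nextMean : VSet n → (VSet n → ℚ) → ℚ
  nextMean B g = sumSets (λ B′ → trans (K n) B B′ * g B′)

  nextMean-1 : ∀ B → nextMean B (λ _ → 1ℚ) ≡ 1ℚ
  nextMean-1 B = ≡-trans (sumSets-cong (λ B′ → ≡-trans (ℚ.*-identityʳ _) (trans-K B B′)))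
                     (sumSets-product-normalised n (roundLaw B) (roundLaw-normalised B))

  nextMean-mono-≤ : ∀ B {g h : VSet n → ℚ} → (∀ S → g S ≤ h S) → nextMean B g ≤ nextMean B h
  nextMean-mono-≤ B g≤h = sumℚ-mono-≤ (allSets n) (λ S → *-monoˡ-≤-0≤ (0≤trans B S) (g≤h S))

  becomesBlue≤ : ∀ B w → roundLaw B w true ≤ 𝟙 (B w) + fromℕ ∣ B ∣ * p B
  becomesBlue≤ B w = law-true≤ (B w) (0≤* (0≤fromℕ ∣ B ∣) (0≤p B)) λ Bw≡false → begin
    1ℚ - stayWhite (K n) B w                   ≡⟨ cong (1ℚ -_) (stayWhite-K B w) ⟩
    1ℚ - prodFin (λ u → miss (c u) (p B))      ≤⟨ union-bound c (p B) (0≤p B) (p≤1 B (∣∣≤n-missing B w Bw≡false)) ⟩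
    fromℕ ∣ c ∣ * p B                          ≤⟨ *-monoʳ-≤-0≤ (0≤p B) (fromℕ-mono-≤ (∣∧∣≤∣∣ B (λ u → K n u w))) ⟩
    fromℕ ∣ B ∣ * p B                          ∎
    where
    open ℚ.≤-Reasoning
    c = λ u → B u ∧ K n u w

  nextMean-size≤ : ∀ B → let s = fromℕ ∣ B ∣ in nextMean B (λ S → fromℕ ∣ S ∣) ≤ s + (s * s + s * s)
  nextMean-size≤ B = begin
    nextMean B (λ S → fromℕ ∣ S ∣)
      ≡⟨ sumSets-cong (λ S → cong (_* fromℕ ∣ S ∣) (trans-K B S)) ⟩
    sumSets (λ S → product (roundLaw B) S * fromℕ ∣ S ∣)
      ≡⟨ sumSets-product-size n (roundLaw B) (roundLaw-normalised B) ⟩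
    sumFin (λ w → roundLaw B w true)
      ≤⟨ sumFin-mono-≤ (becomesBlue≤ B) ⟩
    sumFin (λ w → 𝟙 (B w) + s * p B)
      ≡⟨ sumFin-+ (λ w → 𝟙 (B w)) (λ _ → s * p B) ⟩
    sumFin (λ w → 𝟙 (B w)) + sumFin {n} (λ _ → s * p B)
      ≡⟨ cong₂ _+_ (sumFin-𝟙 B) (sumFin-const n (s * p B)) ⟩
    s + fromℕ n * (s * p B)
      ≤⟨ +-mono-≤ (≤-refl {s}) (*-monoʳ-≤-0≤ (0≤* (0≤fromℕ ∣ B ∣) (0≤p B)) n≤r+r) ⟩
    s + (r + r) * (s * p B)
      ≡⟨ cong (λ z → s + z) (regroup s (p B) r) ⟩
    s + (s * (p B * r) + s * (p B * r))
      ≡⟨ cong (λ z → s + (s * z + s * z)) (p*r B) ⟩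
    s + (s * s + s * s)
      ∎
    where
    open ℚ.≤-Reasoning
    s = fromℕ ∣ B ∣
    n≤r+r : fromℕ n ≤ r + r
    n≤r+r = ≤-trans (≤-reflexive (fromℕ-suc (suc k))) (+-mono-≤ (fromℕ-mono-≤ {1} {suc k} (s≤s z≤n)) (≤-refl {r}))
    regroup : ∀ s p r → (r + r) * (s * p) ≡ s * (p * r) + s * (p * r)
    regroup = solve 3 (λ s p r → (r :+ r) :* (s :* p) := s :* (p :* r) :+ s :* (p :* r)) refl

  nextMean-*ˡ : ∀ B c g → nextMean B (λ S → c * g S) ≡ c * nextMean B g
  nextMean-*ˡ B c g = ≡-trans (sumSets-cong (λ S → exchange (trans (K n) B S) c (g S)))
                          (sumℚ-*ˡ (allSets n) c (λ S → trans (K n) B S * g S))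
    where
    exchange : ∀ a b c → a * (b * c) ≡ b * (a * c)
    exchange = solve 3 (λ a b c → a :* (b :* c) := b :* (a :* c)) refl

  nextMean-exceeds≤ : ∀ {m M ε} → 1 ℕ.≤ m → 1 ℕ.≤ M → 0ℚ ≤ ε → fromℕ M * ε ≡ fromℕ (3 ℕ.* (m ℕ.* m)) →
    ∀ B → nextMean B (exceeds M) ≤ exceeds m B + ε
  nextMean-exceeds≤ {m} {M} {ε} 1≤m 1≤M 0≤ε M*ε≡3m² B = ≤-𝟙+ (m ℕ.<? ∣ B ∣) 0≤ε nextMean-exceeds≤1 nextMean-exceeds≤ε
    where
    open ℚ.≤-Reasoning
    nextMean-exceeds≤1 : nextMean B (exceeds M) ≤ 1ℚ
    nextMean-exceeds≤1 = ≤-trans (nextMean-mono-≤ B (λ S → 𝟙≤1 (isYes (M ℕ.<? ∣ S ∣)))) (≤-reflexive (nextMean-1 B))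
    nextMean-exceeds≤ε : ¬ m ℕ.< ∣ B ∣ → nextMean B (exceeds M) ≤ ε
    nextMean-exceeds≤ε m≮∣B∣ = *-cancelˡ-≤-pos (fromℕ M) {{fromℕ-pos 1≤M}} (begin
      fromℕ M * nextMean B (exceeds M)          ≡⟨ sym (nextMean-*ˡ B (fromℕ M) (exceeds M)) ⟩
      nextMean B (λ S → fromℕ M * exceeds M S)  ≤⟨ nextMean-mono-≤ B (M*exceeds≤∣∣ M) ⟩
      nextMean B (λ S → fromℕ ∣ S ∣)            ≤⟨ nextMean-size≤ B ⟩
      _                                         ≤⟨ s+2s²≤3m² (ℕ.≮⇒≥ m≮∣B∣) 1≤m ⟩
      fromℕ (3 ℕ.* (m ℕ.* m))                   ≡⟨ sym M*ε≡3m² ⟩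
      fromℕ M * ε                               ∎)

-- The process on the complete graph

module Process (k : ℕ) (Z : VSet (suc (suc k))) where
  open CompleteGraph k

  μ : ℕ → VSet n → ℚ
  μ = dist (K n) Z

  𝔼 : ℕ → (VSet n → ℚ) → ℚ
  𝔼 t g = sumSets (λ B → μ t B * g B)

  0≤μ : ∀ t B → 0ℚ ≤ μ t B
  0≤μ zero B = 0≤𝟙 (eqSet B Z)
  0≤μ (suc t) B′ = 0≤sumℚ (allSets n) (λ B → 0≤* (0≤μ t B) (0≤trans B B′))

  μ-ext : ∀ t → Extensional (μ t)
  μ-ext zero S≗S′ = cong 𝟙 (eqSet-congˡ Z S≗S′)
  μ-ext (suc t) S≗S′ = sumSets-cong (λ B → cong (μ t B *_) (trans-ext B S≗S′))

  𝔼-suc : ∀ t g → 𝔼 (suc t) g ≡ 𝔼 t (λ B → nextMean B g)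
  𝔼-suc t g = begin
    sumSets (λ B′ → sumSets (λ B → μ t B * trans (K n) B B′) * g B′)
      ≡⟨ sumSets-cong (λ B′ → sym (sumℚ-*ʳ (allSets n) (g B′) (λ B → μ t B * trans (K n) B B′))) ⟩
    sumSets (λ B′ → sumSets (λ B → μ t B * trans (K n) B B′ * g B′))
      ≡⟨ sumℚ-swap (allSets n) (allSets n) (λ B′ B → μ t B * trans (K n) B B′ * g B′) ⟩
    sumSets (λ B → sumSets (λ B′ → μ t B * trans (K n) B B′ * g B′))
      ≡⟨ sumSets-cong (λ B → sumSets-cong (λ B′ → ℚ.*-assoc (μ t B) (trans (K n) B B′) (g B′))) ⟩
    sumSets (λ B → sumSets (λ B′ → μ t B * (trans (K n) B B′ * g B′)))
      ≡⟨ sumSets-cong (λ B → sumℚ-*ˡ (allSets n) (μ t B) (λ B′ → trans (K n) B B′ * g B′)) ⟩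
    sumSets (λ B → μ t B * nextMean B g)
      ∎
    where open ≡-Reasoning

  𝔼-mono-≤ : ∀ t {g h : VSet n → ℚ} → (∀ S → g S ≤ h S) → 𝔼 t g ≤ 𝔼 t h
  𝔼-mono-≤ t g≤h = sumℚ-mono-≤ (allSets n) (λ S → *-monoˡ-≤-0≤ (0≤μ t S) (g≤h S))

  𝔼-+ : ∀ t (g h : VSet n → ℚ) → 𝔼 t (λ B → g B + h B) ≡ 𝔼 t g + 𝔼 t h
  𝔼-+ t g h = ≡-trans (sumSets-cong (λ B → ℚ.*-distribˡ-+ (μ t B) (g B) (h B))) (sumℚ-+ (allSets n) _ _)

  𝔼-1 : ∀ t → 𝔼 t (λ _ → 1ℚ) ≡ 1ℚ
  𝔼-1 zero = ≡-trans (sumSets-cong (λ B → ≡-trans (ℚ.*-identityʳ _) (𝟙-eqSet B Z)))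
                     (sumSets-product-normalised n (λ w b → 𝟙 (isYes (b Bool.≟ Z w))) (λ w → point-mass (Z w)))
    where
    point-mass : ∀ z → 𝟙 (isYes (false Bool.≟ z)) + 𝟙 (isYes (true Bool.≟ z)) ≡ 1ℚ
    point-mass false = ℚ.+-identityʳ 1ℚ
    point-mass true = ℚ.+-identityˡ 1ℚ
  𝔼-1 (suc t) = ≡-trans (𝔼-suc t (λ _ → 1ℚ)) (≡-trans (sumSets-cong (λ B → cong (μ t B *_) (nextMean-1 B))) (𝔼-1 t))

  𝔼-const : ∀ t c → 𝔼 t (λ _ → c) ≡ c
  𝔼-const t c = begin
    sumSets (λ B → μ t B * c)           ≡⟨ sumSets-cong (λ B → cong (_* c) (sym (ℚ.*-identityʳ (μ t B)))) ⟩
    sumSets (λ B → μ t B * 1ℚ * c)      ≡⟨ sumℚ-*ʳ (allSets n) c (λ B → μ t B * 1ℚ) ⟩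
    𝔼 t (λ _ → 1ℚ) * c                  ≡⟨ cong (_* c) (𝔼-1 t) ⟩
    1ℚ * c                              ≡⟨ ℚ.*-identityˡ c ⟩
    c                                   ∎
    where open ≡-Reasoning

  𝔼-exceeds-suc≤ : ∀ t {m M ε} → 1 ℕ.≤ m → 1 ℕ.≤ M → 0ℚ ≤ ε → fromℕ M * ε ≡ fromℕ (3 ℕ.* (m ℕ.* m)) →
    𝔼 (suc t) (exceeds M) ≤ 𝔼 t (exceeds m) + ε
  𝔼-exceeds-suc≤ t {m} {M} {ε} 1≤m 1≤M 0≤ε M*ε≡3m² = begin
    𝔼 (suc t) (exceeds M)                ≡⟨ 𝔼-suc t (exceeds M) ⟩
    𝔼 t (λ B → nextMean B (exceeds M))   ≤⟨ 𝔼-mono-≤ t (nextMean-exceeds≤ 1≤m 1≤M 0≤ε M*ε≡3m²) ⟩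
    𝔼 t (λ B → exceeds m B + ε)          ≡⟨ 𝔼-+ t (exceeds m) (λ _ → ε) ⟩
    𝔼 t (exceeds m) + 𝔼 t (λ _ → ε)      ≡⟨ cong (λ z → 𝔼 t (exceeds m) + z) (𝔼-const t ε) ⟩
    𝔼 t (exceeds m) + ε                  ∎
    where open ℚ.≤-Reasoning

  𝔼₀-exceeds-1 : ∣ Z ∣ ≡ 1 → 𝔼 0 (exceeds 1) ≡ 0ℚ
  𝔼₀-exceeds-1 ∣Z∣≡1 = ≡-trans (sumSets-cong vanish) (sumℚ-zero (allSets n))
    where
    vanish : ∀ B → 𝟙 (eqSet B Z) * exceeds 1 B ≡ 0ℚ
    vanish B with eqSet B Z in B≟Z
    ... | true = ≡-trans (ℚ.*-identityˡ _)
                   (exceeds-singleton B (≡-trans (∣∣-cong (eqSet-sound B Z B≟Z)) ∣Z∣≡1))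
    ... | false = ℚ.*-zeroˡ (exceeds 1 B)

  μ-full≤ : ∀ t M → M ℕ.< n → μ t full ≤ 𝔼 t (exceeds M)
  μ-full≤ t M M<n = ≤-trans (≤-reflexive (≡-trans (sym (ℚ.*-identityʳ (μ t full)))
                                                   (cong (μ t full *_) (sym (exceeds-full n M M<n)))))
    (≤-sumSets-full n (λ B → μ t B * exceeds M B) (λ S≗S′ → cong₂ _*_ (μ-ext t S≗S′) (exceeds-ext M S≗S′))
                      (λ S → 0≤* (0≤μ t S) (0≤𝟙 _)))

-- Thresholds

slack : ℕ → ℚ
slack zero = ½
slack (suc t) = ½ * slack t

0≤slack : ∀ t → 0ℚ ≤ slack t
0≤slack zero = ℚ.≤ᵇ⇒≤ _
0≤slack (suc t) = 0≤* {½} (ℚ.≤ᵇ⇒≤ _) (0≤slack t)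

2^[1+t]*slack≡1 : ∀ t → fromℕ (2 ℕ.^ suc t) * slack t ≡ 1ℚ
2^[1+t]*slack≡1 zero = refl
2^[1+t]*slack≡1 (suc t) = begin
  fromℕ (2 ℕ.* 2 ℕ.^ suc t) * (½ * slack t)       ≡⟨ cong (_* (½ * slack t)) (fromℕ-* 2 (2 ℕ.^ suc t)) ⟩
  fromℕ 2 * fromℕ (2 ℕ.^ suc t) * (½ * slack t)   ≡⟨ interchange (fromℕ 2) (fromℕ (2 ℕ.^ suc t)) ½ (slack t) ⟩
  (fromℕ 2 * ½) * (fromℕ (2 ℕ.^ suc t) * slack t) ≡⟨ cong ((fromℕ 2 * ½) *_) (2^[1+t]*slack≡1 t) ⟩
  1ℚ                                              ∎
  where
  open ≡-Reasoning
  interchange : ∀ a b c d → a * b * (c * d) ≡ (a * c) * (b * d)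
  interchange = solve 4 (λ a b c d → a :* b :* (c :* d) := (a :* c) :* (b :* d)) refl

-- threshold (suc t) * slack (suc t) = 3 * threshold t ², so Markov's inequality turns the bound
-- E|B′| ≤ 3 * threshold t ² into P(|B′| > threshold (suc t)) ≤ slack (suc t).
threshold : ℕ → ℕ
threshold zero = 1
threshold (suc t) = 3 ℕ.* (threshold t ℕ.* threshold t) ℕ.* 2 ℕ.^ (2 ℕ.+ t)

1≤2^ : ∀ t → 1 ℕ.≤ 2 ℕ.^ t
1≤2^ t = ℕ.m^n>0 2 t

1≤threshold : ∀ t → 1 ℕ.≤ threshold t
1≤threshold zero = s≤s z≤n
1≤threshold (suc t) =
  ℕ.*-mono-≤ {1} {_} {1} (ℕ.*-mono-≤ {1} {3} (s≤s z≤n) (ℕ.*-mono-≤ (1≤threshold t) (1≤threshold t))) (1≤2^ (2 ℕ.+ t))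

threshold-suc≤ : ∀ t → threshold t ℕ.≤ threshold (suc t)
threshold-suc≤ t = begin
  m                                       ≤⟨ ℕ.m≤m*n m m {{ℕ.>-nonZero (1≤threshold t)}} ⟩
  m ℕ.* m                                 ≤⟨ ℕ.m≤m+n (m ℕ.* m) _ ⟩
  3 ℕ.* (m ℕ.* m)                         ≤⟨ ℕ.m≤m*n (3 ℕ.* (m ℕ.* m)) (2 ℕ.^ (2 ℕ.+ t)) {{ℕ.>-nonZero (1≤2^ (2 ℕ.+ t))}} ⟩
  3 ℕ.* (m ℕ.* m) ℕ.* 2 ℕ.^ (2 ℕ.+ t)     ∎
  where
  open ℕ.≤-Reasoning
  m = threshold t

threshold*slack : ∀ t → fromℕ (threshold (suc t)) * slack (suc t) ≡ fromℕ (3 ℕ.* (threshold t ℕ.* threshold t))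
threshold*slack t = begin
  fromℕ (c ℕ.* 2 ℕ.^ (2 ℕ.+ t)) * slack (suc t)        ≡⟨ cong (_* slack (suc t)) (fromℕ-* c (2 ℕ.^ (2 ℕ.+ t))) ⟩
  fromℕ c * fromℕ (2 ℕ.^ (2 ℕ.+ t)) * slack (suc t)    ≡⟨ ℚ.*-assoc (fromℕ c) _ _ ⟩
  fromℕ c * (fromℕ (2 ℕ.^ (2 ℕ.+ t)) * slack (suc t))  ≡⟨ cong (fromℕ c *_) (2^[1+t]*slack≡1 (suc t)) ⟩
  fromℕ c * 1ℚ                                         ≡⟨ ℚ.*-identityʳ (fromℕ c) ⟩
  fromℕ c                                              ∎
  where
  open ≡-Reasoning
  c = 3 ℕ.* (threshold t ℕ.* threshold t)

threshold*2^≤2^2^ : ∀ t → threshold t ℕ.* 2 ℕ.^ (6 ℕ.+ t) ℕ.≤ 2 ℕ.^ (2 ℕ.^ (3 ℕ.+ t))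
threshold*2^≤2^2^ zero = ℕ.≤ᵇ⇒≤ 64 256 _
threshold*2^≤2^2^ (suc t) = begin
  threshold (suc t) ℕ.* 2 ℕ.^ (7 ℕ.+ t)                          ≤⟨ ℕ.m≤m+n _ (2560 ℕ.* (m ℕ.* m ℕ.* (x ℕ.* x))) ⟩
  _                                                              ≡⟨ expand m x ⟩
  (m ℕ.* 2 ℕ.^ (6 ℕ.+ t)) ℕ.* (m ℕ.* 2 ℕ.^ (6 ℕ.+ t))            ≤⟨ ℕ.*-mono-≤ (threshold*2^≤2^2^ t) (threshold*2^≤2^2^ t) ⟩
  2 ℕ.^ y ℕ.* 2 ℕ.^ y                                            ≡⟨ sym (ℕ.^-distribˡ-+-* 2 y y) ⟩
  2 ℕ.^ (y ℕ.+ y)                                                ≡⟨ cong (λ z → 2 ℕ.^ (y ℕ.+ z)) (sym (ℕ.+-identityʳ y)) ⟩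
  2 ℕ.^ (2 ℕ.^ (4 ℕ.+ t))                                        ∎
  where
  open ℕ.≤-Reasoning
  open ℕSolver.+-*-Solver using () renaming (solve to solveℕ; _:=_ to _:=ℕ_; _:+_ to _:+ℕ_; _:*_ to _:*ℕ_; con to conℕ)
  m = threshold t
  x = 2 ℕ.^ t
  y = 2 ℕ.^ (3 ℕ.+ t)
  expand : ∀ m x →
    3 ℕ.* (m ℕ.* m) ℕ.* (2 ℕ.* (2 ℕ.* x)) ℕ.* (2 ℕ.* (2 ℕ.* (2 ℕ.* (2 ℕ.* (2 ℕ.* (2 ℕ.* (2 ℕ.* x)))))))
      ℕ.+ 2560 ℕ.* (m ℕ.* m ℕ.* (x ℕ.* x))
    ≡ (m ℕ.* (2 ℕ.* (2 ℕ.* (2 ℕ.* (2 ℕ.* (2 ℕ.* (2 ℕ.* x)))))))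
      ℕ.* (m ℕ.* (2 ℕ.* (2 ℕ.* (2 ℕ.* (2 ℕ.* (2 ℕ.* (2 ℕ.* x)))))))
  expand = solveℕ 2 (λ m x →
    conℕ 3 :*ℕ (m :*ℕ m) :*ℕ (d (d x)) :*ℕ (d (d (d (d (d (d (d x)))))))
      :+ℕ conℕ 2560 :*ℕ (m :*ℕ m :*ℕ (x :*ℕ x))
    :=ℕ (m :*ℕ (d (d (d (d (d (d x))))))) :*ℕ (m :*ℕ (d (d (d (d (d (d x)))))))) refl
    where
    d = λ e → conℕ 2 :*ℕ e

2^⌊log2⌋≤ : ∀ x (rec : Acc ℕ._<_ x) → 1 ℕ.≤ x → 2 ℕ.^ ⌊log2⌋ x rec ℕ.≤ x
2^⌊log2⌋≤ (suc zero) _ _ = s≤s z≤n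
2^⌊log2⌋≤ (suc (suc x)) (acc rs) _ =
  ℕ.≤-trans (ℕ.*-monoʳ-≤ 2 (2^⌊log2⌋≤ (suc h) (rs (ℕ.⌊n/2⌋<n (suc x))) (s≤s z≤n))) 2*[1+h]≤2+x
  where
  h = ℕ.⌊ x /2⌋
  h+h≤x : h ℕ.+ h ℕ.≤ x
  h+h≤x = ℕ.≤-trans (ℕ.+-monoʳ-≤ h (ℕ.⌊n/2⌋≤⌈n/2⌉ x)) (ℕ.≤-reflexive (ℕ.⌊n/2⌋+⌈n/2⌉≡n x))
  2*[1+h]≤2+x : 2 ℕ.* suc h ℕ.≤ suc (suc x)
  2*[1+h]≤2+x = subst (ℕ._≤ suc (suc x)) (sym (cong (suc h ℕ.+_) (ℕ.+-identityʳ (suc h))))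
                  (s≤s (subst (ℕ._≤ suc x) (sym (ℕ.+-suc h h)) (s≤s h+h≤x)))

2^⌊log₂⌋≤ : ∀ x → 1 ℕ.≤ x → 2 ℕ.^ ⌊log₂ x ⌋ ℕ.≤ x
2^⌊log₂⌋≤ x = 2^⌊log2⌋≤ x (<-wellFounded x)

threshold[loglog∸3]<n : ∀ k → threshold (loglog (suc (suc k)) ℕ.∸ 3) ℕ.< suc (suc k)
threshold[loglog∸3]<n k with 3 ℕ.≤? loglog (suc (suc k))
... | no 3≰L = subst (λ z → threshold z ℕ.< suc (suc k)) (sym (ℕ.m≤n⇒m∸n≡0 (ℕ.<⇒≤ (ℕ.≰⇒> 3≰L)))) (s≤s (s≤s z≤n))
... | yes 3≤L = begin-strict
  threshold T                                ≡⟨ ℕ.*-identityʳ (threshold T) ⟨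
  threshold T ℕ.* 1                          <⟨ ℕ.*-monoʳ-< (threshold T) {{ℕ.>-nonZero (1≤threshold T)}} 1<2^[6+T] ⟩
  threshold T ℕ.* 2 ℕ.^ (6 ℕ.+ T)            ≤⟨ threshold*2^≤2^2^ T ⟩
  2 ℕ.^ (2 ℕ.^ (3 ℕ.+ T))                    ≡⟨ cong (λ z → 2 ℕ.^ (2 ℕ.^ z)) (ℕ.m+[n∸m]≡n 3≤L) ⟩
  2 ℕ.^ (2 ℕ.^ L)                            ≤⟨ ℕ.^-monoʳ-≤ 2 (2^⌊log₂⌋≤ x (⌊log₂⌋-mono-≤ {2} {suc (suc k)} (s≤s (s≤s z≤n)))) ⟩
  2 ℕ.^ x                                    ≤⟨ 2^⌊log₂⌋≤ (suc (suc k)) (s≤s z≤n) ⟩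
  suc (suc k)                                ∎
  where
  open ℕ.≤-Reasoning
  L = loglog (suc (suc k))
  T = L ℕ.∸ 3
  x = ⌊log₂ suc (suc k) ⌋
  1<2^[6+T] : 1 ℕ.< 2 ℕ.^ (6 ℕ.+ T)
  1<2^[6+T] = ℕ.*-monoʳ-≤ 2 (1≤2^ (5 ℕ.+ T))

-- Expected propagation time from a single vertex

module FromSingleton (k : ℕ) (v : Fin (suc (suc k))) where
  open CompleteGraph k
  open Process k (single v)

  𝔼-exceeds-threshold≤ : ∀ t → 𝔼 t (exceeds (threshold t)) ≤ ½ - slack t
  𝔼-exceeds-threshold≤ zero = ≤-reflexive (𝔼₀-exceeds-1 (∣single∣ v))
  𝔼-exceeds-threshold≤ (suc t) = begin
    𝔼 (suc t) (exceeds (threshold (suc t)))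
      ≤⟨ 𝔼-exceeds-suc≤ t (1≤threshold t) (1≤threshold (suc t)) (0≤slack (suc t)) (threshold*slack t) ⟩
    𝔼 t (exceeds (threshold t)) + ½ * slack t
      ≤⟨ +-mono-≤ (𝔼-exceeds-threshold≤ t) ≤-refl ⟩
    ½ - slack t + ½ * slack t
      ≡⟨ solve 1 (λ d → con ½ :- d :+ con ½ :* d := con ½ :- con ½ :* d) refl (slack t) ⟩
    ½ - ½ * slack t
      ∎
    where open ℚ.≤-Reasoning

  ½≤tailProb : ∀ t → threshold t ℕ.< n → ½ ≤ tailProb (K n) (single v) t
  ½≤tailProb t threshold<n = +-mono-≤ (≤-refl {1ℚ}) (neg-antimono-≤ μ-full≤½)
    where
    μ-full≤½ : μ t full ≤ ½
    μ-full≤½ = ≤-trans (μ-full≤ t (threshold t) threshold<n)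
                 (≤-trans (𝔼-exceeds-threshold≤ t) (+-mono-≤ (≤-refl {½}) (neg-antimono-≤ (0≤slack t))))

  [1+T]/2≤partialEpt : ∀ T → threshold T ℕ.< n → fromℕ (suc T) * ½ ≤ partialEpt (K n) (single v) T
  [1+T]/2≤partialEpt zero threshold<n = ≤-trans (≤-reflexive (ℚ.*-identityˡ ½)) (½≤tailProb 0 threshold<n)
  [1+T]/2≤partialEpt (suc T) threshold<n = begin
    fromℕ (suc (suc T)) * ½      ≡⟨ cong (_* ½) (fromℕ-suc (suc T)) ⟩
    (1ℚ + fromℕ (suc T)) * ½     ≡⟨ solve 1 (λ a → (con 1ℚ :+ a) :* con ½ := a :* con ½ :+ con ½) refl (fromℕ (suc T)) ⟩
    fromℕ (suc T) * ½ + ½        ≤⟨ +-mono-≤ ([1+T]/2≤partialEpt T (ℕ.≤-<-trans (threshold-suc≤ T) threshold<n))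
                                             (½≤tailProb (suc T) threshold<n) ⟩
    partialEpt (K n) (single v) (suc T) ∎
    where open ℚ.≤-Reasoning

L/8≤[1+[L∸3]]/2 : ∀ L → (+ 1) / 8 * fromℕ L ≤ fromℕ (suc (L ℕ.∸ 3)) * ½
L/8≤[1+[L∸3]]/2 L = *-cancelʳ-≤-pos (fromℕ 8) {{fromℕ-pos {8} (s≤s z≤n)}} (begin
  (+ 1) / 8 * fromℕ L * fromℕ 8          ≡⟨ exchange ((+ 1) / 8) (fromℕ L) (fromℕ 8) ⟩
  fromℕ L * ((+ 1) / 8 * fromℕ 8)        ≡⟨ cong (fromℕ L *_) (/-*-fromℕ 1 7) ⟩
  fromℕ L * 1ℚ                           ≡⟨ ℚ.*-identityʳ (fromℕ L) ⟩
  fromℕ L                                ≤⟨ fromℕ-mono-≤ L≤4[1+[L∸3]] ⟩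
  fromℕ (suc (L ℕ.∸ 3) ℕ.* 4)            ≡⟨ fromℕ-* (suc (L ℕ.∸ 3)) 4 ⟩
  fromℕ (suc (L ℕ.∸ 3)) * (½ * fromℕ 8)  ≡⟨ ℚ.*-assoc (fromℕ (suc (L ℕ.∸ 3))) ½ (fromℕ 8) ⟨
  fromℕ (suc (L ℕ.∸ 3)) * ½ * fromℕ 8    ∎)
  where
  open ℚ.≤-Reasoning
  exchange : ∀ a b c → a * b * c ≡ b * (a * c)
  exchange = solve 3 (λ a b c → a :* b :* c := b :* (a :* c)) refl
  L≤4[1+[L∸3]] : L ℕ.≤ suc (L ℕ.∸ 3) ℕ.* 4
  L≤4[1+[L∸3]] = ℕ.≤-trans (ℕ.m≤n+m∸n L 3) (ℕ.+-mono-≤ {3} {4} (s≤s (s≤s (s≤s z≤n))) (ℕ.m≤m*n (L ℕ.∸ 3) 4))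

ept-K≥loglog/8 : (n : ℕ) → n ≥ 2 → EptGAtLeast (K n) ((+ 1) / 8 * fromℕ (loglog n))
ept-K≥loglog/8 (suc zero) (s≤s ())
ept-K≥loglog/8 (suc (suc k)) _ v =
  T , ≤-trans (L/8≤[1+[L∸3]]/2 L) (FromSingleton.[1+T]/2≤partialEpt k v T (threshold[loglog∸3]<n k))
  where
  L = loglog (suc (suc k))
  T = L ℕ.∸ 3

proposition2p8 : Σ ℚ λ c → Positive c × ∃ λ N → (n : ℕ) → n ≥ N →
    EptGAtLeast (K n) (c * ((+ loglog n) / 1))
proposition2p8 = (+ 1) / 8 , _ , 2 , ept-K≥loglog/8
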